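{- Let $H = I_7 \vee C_5$, where $I_7$ is an independent set on $7$ vertices and $C_5$ is a $5$-cycle. For every positive integer $n$, let $H^{2n}$ be the $2n$-blow-up of $H$. Then $$D_{2,\infty}^b(H^{2n}) = \frac{37}{24^2}\,|H^{2n}|^2 > \frac{|H^{2n}|^2}{16}.$$
   Context: All graphs are simple. For a vertex subset $A$ of a graph $G$, $e(A)$ denotes the number of edges of $G$ with both endpoints in $A$, and $A^c = V(G)\setminus A$. A balanced $2$-partition of a graph $G$ on an even number of vertices is a partition $V(G) = A \cup A^c$ with $|A| = |A^c|$. Define $D_{2,\infty}^b(G) = \min_A \max\{e(A), e(A^c)\}$, the minimum over all balanced $2$-partitions. The join $G_1 \vee G_2$ of two vertex-disjoint graphs has vertex set $V(G_1)\cup V(G_2)$ and edge set $E(G_1)\cup E(G_2)\cup\{v_1v_2 : v_1\in V(G_1), v_2 \in V(G_2)\}$. The $k$-blow-up $G^k$ of $G$ is obtained by replacing each vertex $v$ by $k$ vertices (copies of $v$), where a copy of $u$ is adjacent to a copy of $v$ iff $uv \in E(G)$. $|G|$ denotes the number of vertices. -}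

module Defs where

open import Data.Nat using (ℕ; NonZero; zero; suc; _+_; _*_; _≡ᵇ_; _<ᵇ_; _%_)
open import Data.Nat.Properties using (≡⇒≡ᵇ)
open import Data.Bool using (Bool; true; false; _∧_; _∨_; not; if_then_else_)
open import Data.Bool.Properties using (∨-comm; ∧-comm)
open import Data.Fin using (Fin; toℕ; splitAt; quotient)
open import Data.Sum using (inj₁; inj₂)
open import Data.Product using (Σ; _×_; _,_)
open import Relation.Binary.PropositionalEquality using (_≡_; refl; cong; cong₂; trans)

record Graph : Set where
  field
    size  : ℕ
    adj   : Fin size → Fin size → Bool
    sym   : ∀ i j → adj i j ≡ adj j i
    loopless : ∀ i → adj i i ≡ false
open Graph public

∣_∣ᵥ : Graph → ℕ
∣ G ∣ᵥ = size G

sumFin : (n : ℕ) → (Fin n → ℕ) → ℕ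
sumFin zero    f = 0
sumFin (suc n) f = f Data.Fin.zero + sumFin n (λ i → f (Data.Fin.suc i))

bool→ℕ : Bool → ℕ
bool→ℕ true  = 1
bool→ℕ false = 0

VSet : Graph → Set
VSet G = Fin (size G) → Bool

compl : (G : Graph) → VSet G → VSet G
compl G A i = not (A i)

card : (G : Graph) → VSet G → ℕ
card G A = sumFin (size G) (λ i → bool→ℕ (A i))

-- e(A): number of edges with both endpoints in A
-- (each edge {i,j} counted once, via toℕ i < toℕ j)
e : (G : Graph) → VSet G → ℕ
e G A = sumFin (size G) λ i → sumFin (size G) λ j →
  bool→ℕ ((toℕ i <ᵇ toℕ j) ∧ A i ∧ A j ∧ adj G i j)

Balanced : (G : Graph) → VSet G → Set
Balanced G A = card G A ≡ card G (compl G A)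

maxE : (G : Graph) → VSet G → ℕ
maxE G A = Data.Nat._⊔_ (e G A) (e G (compl G A))

IsD2∞b : Graph → ℕ → Set
IsD2∞b G d =
  (Σ (VSet G) λ A → Balanced G A × maxE G A ≡ d)
  × (∀ (A : VSet G) → Balanced G A → d Data.Nat.≤ maxE G A)

indep : ℕ → Graph
indep n = record { size = n ; adj = λ _ _ → false
                 ; sym = λ _ _ → refl ; loopless = λ _ → refl }

private
  ≡ᵇ-refl : ∀ m → (m ≡ᵇ m) ≡ true
  ≡ᵇ-refl zero = refl
  ≡ᵇ-refl (suc m) = ≡ᵇ-refl m

  ≡ᵇ-sym : ∀ m n → (m ≡ᵇ n) ≡ (n ≡ᵇ m)
  ≡ᵇ-sym zero zero = refl
  ≡ᵇ-sym zero (suc n) = refl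
  ≡ᵇ-sym (suc m) zero = refl
  ≡ᵇ-sym (suc m) (suc n) = ≡ᵇ-sym m n

cycle : (n : ℕ) → .{{NonZero n}} → Graph
cycle n = record { size = n ; adj = ca ; sym = s ; loopless = l }
  where
  ca : Fin n → Fin n → Bool
  ca i j = not (toℕ i ≡ᵇ toℕ j)
    ∧ ((suc (toℕ i) % n ≡ᵇ toℕ j) ∨ (suc (toℕ j) % n ≡ᵇ toℕ i))
  s : ∀ i j → ca i j ≡ ca j i
  s i j = cong₂ _∧_ (cong not (≡ᵇ-sym (toℕ i) (toℕ j)))
                    (∨-comm (suc (toℕ i) % n ≡ᵇ toℕ j) (suc (toℕ j) % n ≡ᵇ toℕ i))
  l : ∀ i → ca i i ≡ false
  l i rewrite ≡ᵇ-refl (toℕ i) = refl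

join : Graph → Graph → Graph
join G₁ G₂ = record { size = size G₁ + size G₂ ; adj = ja ; sym = s ; loopless = l }
  where
  ja : Fin (size G₁ + size G₂) → Fin (size G₁ + size G₂) → Bool
  ja i j with splitAt (size G₁) i | splitAt (size G₁) j
  ... | inj₁ a | inj₁ b = adj G₁ a b
  ... | inj₂ a | inj₂ b = adj G₂ a b
  ... | inj₁ _ | inj₂ _ = true
  ... | inj₂ _ | inj₁ _ = true
  s : ∀ i j → ja i j ≡ ja j i
  s i j with splitAt (size G₁) i | splitAt (size G₁) j
  ... | inj₁ a | inj₁ b = sym G₁ a b
  ... | inj₂ a | inj₂ b = sym G₂ a b
  ... | inj₁ _ | inj₂ _ = refl
  ... | inj₂ _ | inj₁ _ = refl
  l : ∀ i → ja i i ≡ false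
  l i with splitAt (size G₁) i
  ... | inj₁ a = loopless G₁ a
  ... | inj₂ a = loopless G₂ a

blowup : Graph → ℕ → Graph
blowup G k = record { size = size G * k ; adj = ba ; sym = s ; loopless = l }
  where
  ba : Fin (size G * k) → Fin (size G * k) → Bool
  ba x y = adj G (quotient k x) (quotient k y)
  s : ∀ x y → ba x y ≡ ba y x
  s x y = sym G (quotient k x) (quotient k y)
  l : ∀ x → ba x x ≡ false
  l x = loopless G (quotient k x)

H : Graph
H = join (indep 7) (cycle 5)

-- Write k = 2n. A vertex set A of H^k is seen through its counts: c u ≤ k copies of each vertex u
-- of H. Then e(A) = X·Y + P, where X and Y are the total counts on I₇ and on C₅ and
-- P = Σ yᵢ yᵢ₊₁ is taken along the cycle; balance forces X + Y = 6k, and one of A, Aᶜ has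
-- 2Y ≥ 5k. For that side 4(XY + P) ≥ 37k². If X ≥ 3k, some chord of C₅ has yᵢ + yᵢ₊₃ ≥ k
-- (the five chords weigh 2Y in total), which gives P ≥ kY − 2k², and (2X + 2k)·2Y ≥ 5k·9k since
-- both factors are ≥ 5k with sum 14k. If Y ≥ 3k, the inequalities (k − yᵢ)(k − yᵢ₊₁) ≥ 0 give
-- P ≥ 2kY − 5k², and (X + 2k)·Y ≥ 3k·5k. Equality holds for the set taking all copies of three
-- vertices of I₇ and of two non-adjacent cycle vertices, and half of the copies of a fourth
-- vertex of I₇ and of a cycle vertex adjacent to exactly one of those two; its complement is of
-- the same kind.

module Submission where

open import Defs hiding (sym)
open import Data.Nat
  using (ℕ; zero; suc; _+_; _*_; _^_; _<_; _≤_; _⊔_; _<ᵇ_; _≤?_; z≤n; s≤s; z<s; NonZero; >-nonZero)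
open import Data.Nat.Properties
open import Data.Nat.Tactic.RingSolver using (solve-∀)
open import Algebra.Properties.CommutativeSemigroup +-commutativeSemigroup using (interchange)
open import Algebra.Properties.CommutativeSemigroup *-commutativeSemigroup using (x∙yz≈y∙xz)
open import Data.Bool using (Bool; true; false; _∧_; not)
open import Data.Fin using (Fin; zero; suc; toℕ; _↑ˡ_; _↑ʳ_; combine; quotient; remainder; #_)
open import Data.Fin.Properties using (toℕ-injective; splitAt-↑ˡ; splitAt-↑ʳ; remQuot-combine)
open import Data.Product using (Σ; ∃; _×_; _,_; proj₁; proj₂)
open import Data.Sum using (_⊎_; inj₁; inj₂)
import Data.Sum as Sum
open import Data.Vec using ([]; _∷_; lookup)
open import Function using (_∘_)
open import Relation.Binary.PropositionalEquality
open import Relation.Nullary using (yes; no)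

sumFin-cong : ∀ n {f g : Fin n → ℕ} → (∀ i → f i ≡ g i) → sumFin n f ≡ sumFin n g
sumFin-cong zero    f≗g = refl
sumFin-cong (suc n) f≗g = cong₂ _+_ (f≗g zero) (sumFin-cong n (f≗g ∘ suc))

sumFin-zero : ∀ n {f : Fin n → ℕ} → (∀ i → f i ≡ 0) → sumFin n f ≡ 0
sumFin-zero zero    f≗0 = refl
sumFin-zero (suc n) f≗0 = cong₂ _+_ (f≗0 zero) (sumFin-zero n (f≗0 ∘ suc))

sumFin-const : ∀ n c → sumFin n (λ _ → c) ≡ n * c
sumFin-const zero    c = refl
sumFin-const (suc n) c = cong (c +_) (sumFin-const n c)

sumFin-+ : ∀ n (f g : Fin n → ℕ) → sumFin n (λ i → f i + g i) ≡ sumFin n f + sumFin n g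
sumFin-+ zero    f g = refl
sumFin-+ (suc n) f g = trans (cong (f zero + g zero +_) (sumFin-+ n (f ∘ suc) (g ∘ suc)))
                             (interchange (f zero) (g zero) _ _)

sumFin-*ˡ : ∀ n c (f : Fin n → ℕ) → sumFin n (λ i → c * f i) ≡ c * sumFin n f
sumFin-*ˡ zero    c f = sym (*-zeroʳ c)
sumFin-*ˡ (suc n) c f = trans (cong (c * f zero +_) (sumFin-*ˡ n c (f ∘ suc)))
                              (sym (*-distribˡ-+ c (f zero) _))

sumFin-*ʳ : ∀ n c (f : Fin n → ℕ) → sumFin n (λ i → f i * c) ≡ sumFin n f * c
sumFin-*ʳ n c f = trans (sumFin-cong n (λ i → *-comm (f i) c))
                        (trans (sumFin-*ˡ n c f) (*-comm c _))

sumFin-*-+ : ∀ n (f g : Fin n → ℕ) s →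
  sumFin n (λ i → f i * (g i + s)) ≡ sumFin n (λ i → f i * g i) + sumFin n f * s
sumFin-*-+ n f g s = trans (sumFin-cong n λ i → *-distribˡ-+ (f i) (g i) s)
  (trans (sumFin-+ n _ _) (cong (sumFin n (λ i → f i * g i) +_) (sumFin-*ʳ n s f)))

sumFin-comm : ∀ m n (f : Fin m → Fin n → ℕ) →
  sumFin m (λ i → sumFin n (f i)) ≡ sumFin n (λ j → sumFin m (λ i → f i j))
sumFin-comm zero    n f = sym (sumFin-zero n (λ _ → refl))
sumFin-comm (suc m) n f = trans (cong (sumFin n (f zero) +_) (sumFin-comm m n (f ∘ suc)))
                                (sym (sumFin-+ n (f zero) _))

sumFin-↑ : ∀ m n (f : Fin (m + n) → ℕ) →
  sumFin (m + n) f ≡ sumFin m (λ i → f (i ↑ˡ n)) + sumFin n (λ j → f (m ↑ʳ j))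
sumFin-↑ zero    n f = refl
sumFin-↑ (suc m) n f = trans (cong (f zero +_) (sumFin-↑ m n (f ∘ suc))) (sym (+-assoc (f zero) _ _))

sumFin-combine : ∀ m k (f : Fin (m * k) → ℕ) →
  sumFin (m * k) f ≡ sumFin m (λ u → sumFin k (λ r → f (combine u r)))
sumFin-combine zero    k f = refl
sumFin-combine (suc m) k f = trans (sumFin-↑ k (m * k) f)
  (cong (sumFin k (λ r → f (r ↑ˡ m * k)) +_) (sumFin-combine m k (f ∘ (k ↑ʳ_))))

sumFin-≤ : ∀ n {k} (f : Fin n → ℕ) → (∀ i → f i ≤ k) → sumFin n f ≤ n * k
sumFin-≤ zero    f f≤k = z≤n
sumFin-≤ (suc n) f f≤k = +-mono-≤ (f≤k zero) (sumFin-≤ n (f ∘ suc) (f≤k ∘ suc))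

pigeonhole : ∀ n {k} (f : Fin (suc n) → ℕ) → suc n * k ≤ sumFin (suc n) f → ∃ λ i → k ≤ f i
pigeonhole zero    {k} f k≤f = zero , +-cancelʳ-≤ 0 k (f zero) k≤f
pigeonhole (suc n) {k} f k≤f with k ≤? f zero
... | yes k≤f₀ = zero , k≤f₀
... | no  k≰f₀ with pigeonhole n (f ∘ suc)
      (+-cancelˡ-≤ k _ _ (≤-trans k≤f (+-monoˡ-≤ _ (<⇒≤ (≰⇒> k≰f₀)))))
...   | i , k≤fᵢ = suc i , k≤fᵢ

bool→ℕ-∧ : ∀ x y → bool→ℕ (x ∧ y) ≡ bool→ℕ x * bool→ℕ y
bool→ℕ-∧ true  y = sym (+-identityʳ (bool→ℕ y))
bool→ℕ-∧ false y = refl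

bool→ℕ-not : ∀ x → bool→ℕ x + bool→ℕ (not x) ≡ 1
bool→ℕ-not true  = refl
bool→ℕ-not false = refl

bool→ℕ-≤1 : ∀ x → bool→ℕ x ≤ 1
bool→ℕ-≤1 true  = ≤-refl
bool→ℕ-≤1 false = z≤n

≡⊎[<ᵇ]+[>ᵇ]≡1 : ∀ m n → m ≡ n ⊎ bool→ℕ (m <ᵇ n) + bool→ℕ (n <ᵇ m) ≡ 1
≡⊎[<ᵇ]+[>ᵇ]≡1 zero    zero    = inj₁ refl
≡⊎[<ᵇ]+[>ᵇ]≡1 zero    (suc n) = inj₂ refl
≡⊎[<ᵇ]+[>ᵇ]≡1 (suc m) zero    = inj₂ refl
≡⊎[<ᵇ]+[>ᵇ]≡1 (suc m) (suc n) = Sum.map₁ (cong suc) (≡⊎[<ᵇ]+[>ᵇ]≡1 m n)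

sumFin-upper-twice : ∀ n (f : Fin n → Fin n → ℕ) → (∀ i j → f i j ≡ f j i) → (∀ i → f i i ≡ 0) →
  2 * sumFin n (λ i → sumFin n (λ j → bool→ℕ (toℕ i <ᵇ toℕ j) * f i j))
    ≡ sumFin n (λ i → sumFin n (f i))
sumFin-upper-twice n f f-sym f-diag = begin
  2 * S
    ≡⟨ cong (S +_) (+-identityʳ S) ⟩
  S + S
    ≡⟨ cong (S +_) (sumFin-comm n n upper) ⟩
  S + sumFin n (λ i → sumFin n (λ j → upper j i))
    ≡⟨ sumFin-+ n _ _ ⟨
  sumFin n (λ i → sumFin n (upper i) + sumFin n (λ j → upper j i))
    ≡⟨ sumFin-cong n (λ i → sumFin-+ n _ _) ⟨
  sumFin n (λ i → sumFin n (λ j → upper i j + upper j i))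
    ≡⟨ sumFin-cong n (λ i → sumFin-cong n (split i)) ⟨
  sumFin n (λ i → sumFin n (f i))
    ∎
  where
  open ≡-Reasoning
  upper : Fin n → Fin n → ℕ
  upper i j = bool→ℕ (toℕ i <ᵇ toℕ j) * f i j
  S : ℕ
  S = sumFin n (λ i → sumFin n (upper i))
  split : ∀ i j → f i j ≡ upper i j + upper j i
  split i j with ≡⊎[<ᵇ]+[>ᵇ]≡1 (toℕ i) (toℕ j)
  ... | inj₁ i≡j rewrite toℕ-injective i≡j | f-diag j =
    sym (cong₂ _+_ (*-zeroʳ (bool→ℕ (toℕ j <ᵇ toℕ j))) (*-zeroʳ (bool→ℕ (toℕ j <ᵇ toℕ j))))
  ... | inj₂ p+q≡1 = begin
    f i j                 ≡⟨ *-identityˡ (f i j) ⟨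
    1 * f i j             ≡⟨ cong (_* f i j) p+q≡1 ⟨
    (p + q) * f i j       ≡⟨ *-distribʳ-+ (f i j) p q ⟩
    p * f i j + q * f i j ≡⟨ cong (λ x → p * f i j + q * x) (f-sym i j) ⟩
    p * f i j + q * f j i ∎
    where
    p = bool→ℕ (toℕ i <ᵇ toℕ j)
    q = bool→ℕ (toℕ j <ᵇ toℕ i)

adjacencyForm : (G : Graph) → (Fin (size G) → ℕ) → ℕ
adjacencyForm G c = sumFin (size G) λ u → c u * sumFin (size G) λ v → c v * bool→ℕ (adj G u v)

adjacencyForm-cong : ∀ G {c d : Fin (size G) → ℕ} → (∀ u → c u ≡ d u) →
  adjacencyForm G c ≡ adjacencyForm G d
adjacencyForm-cong G c≗d = sumFin-cong (size G) λ u →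
  cong₂ _*_ (c≗d u) (sumFin-cong (size G) λ v → cong (_* bool→ℕ (adj G u v)) (c≗d v))

2*e≡adjacencyForm : ∀ G A → 2 * e G A ≡ adjacencyForm G (bool→ℕ ∘ A)
2*e≡adjacencyForm G A = begin
  2 * e G A
    ≡⟨ cong (2 *_) (sumFin-cong n λ i → sumFin-cong n (split-∧ i)) ⟩
  2 * sumFin n (λ i → sumFin n λ j → bool→ℕ (toℕ i <ᵇ toℕ j) * w i j)
    ≡⟨ sumFin-upper-twice n w w-sym w-diag ⟩
  sumFin n (λ i → sumFin n (w i))
    ≡⟨ sumFin-cong n (λ i → sumFin-*ˡ n (a i) _) ⟩
  adjacencyForm G a
    ∎
  where
  open ≡-Reasoning
  n = size G
  a : Fin n → ℕ
  a = bool→ℕ ∘ A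
  w : Fin n → Fin n → ℕ
  w i j = a i * (a j * bool→ℕ (adj G i j))
  split-∧ : ∀ i j →
    bool→ℕ ((toℕ i <ᵇ toℕ j) ∧ A i ∧ A j ∧ adj G i j) ≡ bool→ℕ (toℕ i <ᵇ toℕ j) * w i j
  split-∧ i j = trans (bool→ℕ-∧ (toℕ i <ᵇ toℕ j) _) (cong (bool→ℕ (toℕ i <ᵇ toℕ j) *_)
                  (trans (bool→ℕ-∧ (A i) _) (cong (a i *_) (bool→ℕ-∧ (A j) (adj G i j)))))
  w-sym : ∀ i j → w i j ≡ w j i
  w-sym i j = trans (cong (λ x → a i * (a j * bool→ℕ x)) (Graph.sym G i j)) (x∙yz≈y∙xz (a i) (a j) _)
  w-diag : ∀ i → w i i ≡ 0
  w-diag i rewrite loopless G i = trans (cong (a i *_) (*-zeroʳ (a i))) (*-zeroʳ (a i))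

copies : ∀ {m} k → (Fin (m * k) → ℕ) → Fin m → ℕ
copies k c u = sumFin k λ r → c (combine u r)

quotient-combine : ∀ {m} k (u : Fin m) (r : Fin k) → quotient k (combine u r) ≡ u
quotient-combine {m} k u r = cong proj₁ (remQuot-combine {m} {k} u r)

sumFin-blowup : ∀ m k (c : Fin (m * k) → ℕ) (g : Fin m → ℕ) →
  sumFin (m * k) (λ x → c x * g (quotient k x)) ≡ sumFin m (λ u → copies k c u * g u)
sumFin-blowup m k c g = begin
  sumFin (m * k) (λ x → c x * g (quotient k x))
    ≡⟨ sumFin-combine m k _ ⟩
  sumFin m (λ u → sumFin k λ r → c (combine u r) * g (quotient k (combine u r)))
    ≡⟨ sumFin-cong m (λ u → sumFin-cong k λ r →
         cong (c (combine u r) *_) (cong g (quotient-combine k u r))) ⟩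
  sumFin m (λ u → sumFin k λ r → c (combine u r) * g u)
    ≡⟨ sumFin-cong m (λ u → sumFin-*ʳ k (g u) _) ⟩
  sumFin m (λ u → copies k c u * g u)
    ∎
  where open ≡-Reasoning

adjacencyForm-blowup : ∀ G k c → adjacencyForm (blowup G k) c ≡ adjacencyForm G (copies k c)
adjacencyForm-blowup G k c = trans
  (sumFin-cong (size G * k) λ x →
    cong (c x *_) (sumFin-blowup (size G) k c (bool→ℕ ∘ adj G (quotient k x))))
  (sumFin-blowup (size G) k c (λ u → sumFin (size G) λ v → copies k c v * bool→ℕ (adj G u v)))

card-blowup : ∀ G k A → card (blowup G k) A ≡ sumFin (size G) (copies {size G} k (bool→ℕ ∘ A))
card-blowup G k A = sumFin-combine (size G) k (bool→ℕ ∘ A)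

copies-≤ : ∀ {m} k (A : Fin (m * k) → Bool) u → copies {m} k (bool→ℕ ∘ A) u ≤ k
copies-≤ {m} k A u =
  subst (copies {m} k (bool→ℕ ∘ A) u ≤_) (*-identityʳ k)
    (sumFin-≤ k _ (λ r → bool→ℕ-≤1 (A (combine u r))))

sumFin-bool→ℕ-not : ∀ n (A : Fin n → Bool) →
  sumFin n (bool→ℕ ∘ A) + sumFin n (bool→ℕ ∘ not ∘ A) ≡ n
sumFin-bool→ℕ-not n A = begin
  sumFin n (bool→ℕ ∘ A) + sumFin n (bool→ℕ ∘ not ∘ A)  ≡⟨ sumFin-+ n _ _ ⟨
  sumFin n (λ i → bool→ℕ (A i) + bool→ℕ (not (A i)))   ≡⟨ sumFin-cong n (bool→ℕ-not ∘ A) ⟩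
  sumFin n (λ _ → 1)                                    ≡⟨ sumFin-const n 1 ⟩
  n * 1                                                 ≡⟨ *-identityʳ n ⟩
  n                                                     ∎
  where open ≡-Reasoning

copies-compl : ∀ {m} k (A : Fin (m * k) → Bool) u →
  copies {m} k (bool→ℕ ∘ A) u + copies {m} k (bool→ℕ ∘ not ∘ A) u ≡ k
copies-compl k A u = sumFin-bool→ℕ-not k (A ∘ combine u)

card+card-compl : ∀ G A → card G A + card G (compl G A) ≡ size G
card+card-compl G = sumFin-bool→ℕ-not (size G)

balanced⇒2*card≡size : ∀ G A → Balanced G A → 2 * card G A ≡ size G
balanced⇒2*card≡size G A bal = trans (cong (card G A +_) (trans (+-identityʳ _) bal)) (card+card-compl G A)

sumFin-<ᵇ : ∀ k m → m ≤ k → sumFin k (λ r → bool→ℕ (toℕ r <ᵇ m)) ≡ m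
sumFin-<ᵇ zero    zero    z≤n       = refl
sumFin-<ᵇ (suc k) zero    z≤n       = sumFin-zero k (λ _ → refl)
sumFin-<ᵇ (suc k) (suc m) (s≤s m≤k) = cong suc (sumFin-<ᵇ k m m≤k)

realise : ∀ {m} k → (Fin m → ℕ) → Fin (m * k) → Bool
realise {m} k t x = toℕ (remainder {m} k x) <ᵇ t (quotient {m} k x)

copies-realise : ∀ {m} k (t : Fin m → ℕ) → (∀ u → t u ≤ k) →
  ∀ u → copies {m} k (bool→ℕ ∘ realise {m} k t) u ≡ t u
copies-realise {m} k t t≤k u = trans
  (sumFin-cong k λ r → cong (λ p → bool→ℕ (toℕ (proj₂ p) <ᵇ t (proj₁ p))) (remQuot-combine {m} {k} u r))
  (sumFin-<ᵇ k (t u) (t≤k u))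

module _ (G₁ G₂ : Graph) where

  private
    n₁ = size G₁
    n₂ = size G₂

  adj-join-ˡˡ : ∀ i j → adj (join G₁ G₂) (i ↑ˡ n₂) (j ↑ˡ n₂) ≡ adj G₁ i j
  adj-join-ˡˡ i j rewrite splitAt-↑ˡ n₁ i n₂ | splitAt-↑ˡ n₁ j n₂ = refl

  adj-join-ˡʳ : ∀ i j → adj (join G₁ G₂) (i ↑ˡ n₂) (n₁ ↑ʳ j) ≡ true
  adj-join-ˡʳ i j rewrite splitAt-↑ˡ n₁ i n₂ | splitAt-↑ʳ n₁ n₂ j = refl

  adj-join-ʳˡ : ∀ i j → adj (join G₁ G₂) (n₁ ↑ʳ i) (j ↑ˡ n₂) ≡ true
  adj-join-ʳˡ i j rewrite splitAt-↑ʳ n₁ n₂ i | splitAt-↑ˡ n₁ j n₂ = refl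

  adj-join-ʳʳ : ∀ i j → adj (join G₁ G₂) (n₁ ↑ʳ i) (n₁ ↑ʳ j) ≡ adj G₂ i j
  adj-join-ʳʳ i j rewrite splitAt-↑ʳ n₁ n₂ i | splitAt-↑ʳ n₁ n₂ j = refl

  adjacencyForm-join : ∀ c →
    adjacencyForm (join G₁ G₂) c
      ≡ adjacencyForm G₁ (c ∘ (_↑ˡ n₂)) + adjacencyForm G₂ (c ∘ (n₁ ↑ʳ_))
        + 2 * (sumFin n₁ (c ∘ (_↑ˡ n₂)) * sumFin n₂ (c ∘ (n₁ ↑ʳ_)))
  adjacencyForm-join c = begin
    adjacencyForm (join G₁ G₂) c
      ≡⟨ sumFin-↑ n₁ n₂ _ ⟩
    sumFin n₁ (λ i → c₁ i * row (i ↑ˡ n₂)) + sumFin n₂ (λ j → c₂ j * row (n₁ ↑ʳ j))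
      ≡⟨ cong₂ _+_ (sumFin-cong n₁ λ i → cong (c₁ i *_) (row-ˡ i))
                   (sumFin-cong n₂ λ j → cong (c₂ j *_) (row-ʳ j)) ⟩
    sumFin n₁ (λ i → c₁ i * (row₁ i + S₂)) + sumFin n₂ (λ j → c₂ j * (row₂ j + S₁))
      ≡⟨ cong₂ _+_ (sumFin-*-+ n₁ c₁ row₁ S₂) (sumFin-*-+ n₂ c₂ row₂ S₁) ⟩
    (adjacencyForm G₁ c₁ + S₁ * S₂) + (adjacencyForm G₂ c₂ + S₂ * S₁)
      ≡⟨ regroup (adjacencyForm G₁ c₁) (adjacencyForm G₂ c₂) S₁ S₂ ⟩
    adjacencyForm G₁ c₁ + adjacencyForm G₂ c₂ + 2 * (S₁ * S₂)
      ∎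
    where
    open ≡-Reasoning
    c₁ : Fin n₁ → ℕ
    c₁ = c ∘ (_↑ˡ n₂)
    c₂ : Fin n₂ → ℕ
    c₂ = c ∘ (n₁ ↑ʳ_)
    S₁ = sumFin n₁ c₁
    S₂ = sumFin n₂ c₂
    row : Fin (n₁ + n₂) → ℕ
    row u = sumFin (n₁ + n₂) λ v → c v * bool→ℕ (adj (join G₁ G₂) u v)
    row₁ : Fin n₁ → ℕ
    row₁ i = sumFin n₁ λ v → c₁ v * bool→ℕ (adj G₁ i v)
    row₂ : Fin n₂ → ℕ
    row₂ j = sumFin n₂ λ v → c₂ v * bool→ℕ (adj G₂ j v)
    row-ˡ : ∀ i → row (i ↑ˡ n₂) ≡ row₁ i + S₂
    row-ˡ i = trans (sumFin-↑ n₁ n₂ _) (cong₂ _+_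
      (sumFin-cong n₁ λ v → cong (λ x → c₁ v * bool→ℕ x) (adj-join-ˡˡ i v))
      (sumFin-cong n₂ λ v → trans (cong (λ x → c₂ v * bool→ℕ x) (adj-join-ˡʳ i v))
                                  (*-identityʳ (c₂ v))))
    row-ʳ : ∀ j → row (n₁ ↑ʳ j) ≡ row₂ j + S₁
    row-ʳ j = trans (sumFin-↑ n₁ n₂ _) (trans (cong₂ _+_
      (sumFin-cong n₁ λ v → trans (cong (λ x → c₁ v * bool→ℕ x) (adj-join-ʳˡ j v))
                                  (*-identityʳ (c₁ v)))
      (sumFin-cong n₂ λ v → cong (λ x → c₂ v * bool→ℕ x) (adj-join-ʳʳ j v)))
      (+-comm S₁ (row₂ j)))
    regroup : ∀ F₁ F₂ S₁ S₂ → (F₁ + S₁ * S₂) + (F₂ + S₂ * S₁) ≡ F₁ + F₂ + 2 * (S₁ * S₂)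
    regroup = solve-∀

adjacencyForm-indep : ∀ n c → adjacencyForm (indep n) c ≡ 0
adjacencyForm-indep n c = sumFin-zero n λ u →
  trans (cong (c u *_) (sumFin-zero n λ v → *-zeroʳ (c v))) (*-zeroʳ (c u))

cycleForm : (Fin 5 → ℕ) → ℕ
cycleForm y =
  y (# 0) * y (# 1) + y (# 1) * y (# 2) + y (# 2) * y (# 3) + y (# 3) * y (# 4) + y (# 4) * y (# 0)

adjacencyForm-cycle5 : ∀ y → adjacencyForm (cycle 5) y ≡ 2 * cycleForm y
adjacencyForm-cycle5 y = rows (y (# 0)) (y (# 1)) (y (# 2)) (y (# 3)) (y (# 4))
  where
  -- the rows of the adjacency matrix of C₅
  rows : ∀ a b c d e →
      a * (a * 0 + (b * 1 + (c * 0 + (d * 0 + (e * 1 + 0)))))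
    + (b * (a * 1 + (b * 0 + (c * 1 + (d * 0 + (e * 0 + 0)))))
    + (c * (a * 0 + (b * 1 + (c * 0 + (d * 1 + (e * 0 + 0)))))
    + (d * (a * 0 + (b * 0 + (c * 1 + (d * 0 + (e * 1 + 0)))))
    + (e * (a * 1 + (b * 0 + (c * 0 + (d * 1 + (e * 0 + 0)))))
    + 0))))
    ≡ 2 * (a * b + b * c + c * d + d * e + e * a)
  rows = solve-∀

independentCount : (Fin 12 → ℕ) → ℕ
independentCount c = sumFin 7 (c ∘ (_↑ˡ 5))

cycleCounts : (Fin 12 → ℕ) → Fin 5 → ℕ
cycleCounts c = c ∘ (7 ↑ʳ_)

HForm : (Fin 12 → ℕ) → ℕ
HForm c = independentCount c * sumFin 5 (cycleCounts c) + cycleForm (cycleCounts c)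

adjacencyForm-H : ∀ c → adjacencyForm H c ≡ 2 * HForm c
adjacencyForm-H c = begin
  adjacencyForm H c
    ≡⟨ adjacencyForm-join (indep 7) (cycle 5) c ⟩
  adjacencyForm (indep 7) (c ∘ (_↑ˡ 5)) + adjacencyForm (cycle 5) y + 2 * (X * Y)
    ≡⟨ cong₂ (λ a b → a + b + 2 * (X * Y))
             (adjacencyForm-indep 7 (c ∘ (_↑ˡ 5))) (adjacencyForm-cycle5 y) ⟩
  2 * cycleForm y + 2 * (X * Y)
    ≡⟨ +-comm (2 * cycleForm y) _ ⟩
  2 * (X * Y) + 2 * cycleForm y
    ≡⟨ *-distribˡ-+ 2 (X * Y) _ ⟨
  2 * HForm c
    ∎
  where
  open ≡-Reasoning
  y = cycleCounts c
  X = independentCount c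
  Y = sumFin 5 y

2*e-blowup : ∀ G k A → 2 * e (blowup G k) A ≡ adjacencyForm G (copies {size G} k (bool→ℕ ∘ A))
2*e-blowup G k A = trans (2*e≡adjacencyForm (blowup G k) A) (adjacencyForm-blowup G k (bool→ℕ ∘ A))

e-blowup-H : ∀ k A (t : Fin 12 → ℕ) → (∀ u → copies k (bool→ℕ ∘ A) u ≡ t u) →
  e (blowup H k) A ≡ HForm t
e-blowup-H k A t copies≗t = *-cancelˡ-≡ _ _ 2
  (trans (2*e-blowup H k A) (trans (adjacencyForm-cong H copies≗t) (adjacencyForm-H t)))

c*d≤a*b : ∀ {a b c d} → c ≤ a → c ≤ b → a + b ≡ c + d → c * d ≤ a * b
c*d≤a*b {c = c} {d} c≤a c≤b a+b≡c+d
  with s , refl ← m≤n⇒∃[o]m+o≡n c≤a | t , refl ← m≤n⇒∃[o]m+o≡n c≤b = begin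
  c * d                     ≡⟨ cong (c *_) (+-cancelˡ-≡ c d _ (trans (sym a+b≡c+d) (+-assoc c s (c + t)))) ⟩
  c * (s + (c + t))         ≤⟨ m≤m+n _ (s * t) ⟩
  c * (s + (c + t)) + s * t ≡⟨ expand c s t ⟩
  (c + s) * (c + t)         ∎
  where
  open ≤-Reasoning
  expand : ∀ c s t → c * (s + (c + t)) + s * t ≡ (c + s) * (c + t)
  expand = solve-∀

-- (k − a)(k − b) ≥ 0, stated without subtraction.
k*a+k*b≤a*b+k*k : ∀ {a b k} → a ≤ k → b ≤ k → k * a + k * b ≤ a * b + k * k
k*a+k*b≤a*b+k*k {a} {b} a≤k b≤k with s , refl ← m≤n⇒∃[o]m+o≡n a≤k = begin
  (a + s) * a + (a + s) * b          ≡⟨ split a s b ⟩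
  (a + s) * a + a * b + s * b        ≤⟨ +-monoʳ-≤ ((a + s) * a + a * b) (*-monoʳ-≤ s b≤k) ⟩
  (a + s) * a + a * b + s * (a + s)  ≡⟨ merge a s b ⟩
  a * b + (a + s) * (a + s)          ∎
  where
  open ≤-Reasoning
  split : ∀ a s b → (a + s) * a + (a + s) * b ≡ (a + s) * a + a * b + s * b
  split = solve-∀
  merge : ∀ a s b → (a + s) * a + a * b + s * (a + s) ≡ a * b + (a + s) * (a + s)
  merge = solve-∀

cycleForm-≥-edges : ∀ {k} y → (∀ j → y j ≤ k) → 2 * (k * sumFin 5 y) ≤ cycleForm y + 5 * (k * k)
cycleForm-≥-edges {k} y y≤k =
  subst₂ _≤_ (lhs k (y (# 0)) (y (# 1)) (y (# 2)) (y (# 3)) (y (# 4)))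
             (rhs k (y (# 0)) (y (# 1)) (y (# 2)) (y (# 3)) (y (# 4)))
    (+-mono-≤ (+-mono-≤ (+-mono-≤ (+-mono-≤ (edge (# 0) (# 1)) (edge (# 1) (# 2))) (edge (# 2) (# 3)))
      (edge (# 3) (# 4))) (edge (# 4) (# 0)))
  where
  edge : ∀ i j → k * y i + k * y j ≤ y i * y j + k * k
  edge i j = k*a+k*b≤a*b+k*k (y≤k i) (y≤k j)
  lhs : ∀ k a b c d e →
    k * a + k * b + (k * b + k * c) + (k * c + k * d) + (k * d + k * e) + (k * e + k * a)
      ≡ 2 * (k * (a + (b + (c + (d + (e + 0))))))
  lhs = solve-∀
  rhs : ∀ k a b c d e →
    a * b + k * k + (b * c + k * k) + (c * d + k * k) + (d * e + k * k) + (e * a + k * k)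
      ≡ a * b + b * c + c * d + d * e + e * a + 5 * (k * k)
  rhs = solve-∀

-- The edges y₀y₁ and y₂y₃ as in k*a+k*b≤a*b+k*k, and the chord pays for y₄: k·y₄ ≤ y₄y₀ + y₃y₄.
cycleForm-≥-chord : ∀ {k} y → (∀ j → y j ≤ k) → k ≤ y (# 0) + y (# 3) →
  k * sumFin 5 y ≤ cycleForm y + 2 * (k * k)
cycleForm-≥-chord {k} y y≤k k≤chord =
  subst₂ _≤_ (lhs k (y (# 0)) (y (# 1)) (y (# 2)) (y (# 3)) (y (# 4)))
             (rhs k (y (# 0)) (y (# 1)) (y (# 2)) (y (# 3)) (y (# 4)))
    (+-mono-≤ (+-mono-≤ (edge (# 0) (# 1)) (edge (# 2) (# 3)))
              (+-mono-≤ (*-monoˡ-≤ (y (# 4)) k≤chord) (z≤n {y (# 1) * y (# 2)})))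
  where
  edge : ∀ i j → k * y i + k * y j ≤ y i * y j + k * k
  edge i j = k*a+k*b≤a*b+k*k (y≤k i) (y≤k j)
  lhs : ∀ k a b c d e → k * a + k * b + (k * c + k * d) + (k * e + 0) ≡ k * (a + (b + (c + (d + (e + 0)))))
  lhs = solve-∀
  rhs : ∀ k a b c d e →
    a * b + k * k + (c * d + k * k) + ((a + d) * e + b * c)
      ≡ a * b + b * c + c * d + d * e + e * a + 2 * (k * k)
  rhs = solve-∀

next : Fin 5 → Fin 5
next = lookup (# 1 ∷ # 2 ∷ # 3 ∷ # 4 ∷ # 0 ∷ [])

rotate : (Fin 5 → ℕ) → Fin 5 → ℕ
rotate y = y ∘ next

rotateBy : ℕ → (Fin 5 → ℕ) → Fin 5 → ℕ
rotateBy zero    y = y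
rotateBy (suc r) y = rotateBy r (rotate y)

sumFin-rotate : ∀ y → sumFin 5 (rotate y) ≡ sumFin 5 y
sumFin-rotate y = shift (y (# 0)) (y (# 1)) (y (# 2)) (y (# 3)) (y (# 4))
  where
  shift : ∀ a b c d e → b + (c + (d + (e + (a + 0)))) ≡ a + (b + (c + (d + (e + 0))))
  shift = solve-∀

cycleForm-rotate : ∀ y → cycleForm (rotate y) ≡ cycleForm y
cycleForm-rotate y = shift (y (# 0)) (y (# 1)) (y (# 2)) (y (# 3)) (y (# 4))
  where
  shift : ∀ a b c d e → b * c + c * d + d * e + e * a + a * b ≡ a * b + b * c + c * d + d * e + e * a
  shift = solve-∀

cycleForm-≥-rotated-chord : ∀ {k} r y → (∀ j → y j ≤ k) → k ≤ rotateBy r y (# 0) + rotateBy r y (# 3) →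
  k * sumFin 5 y ≤ cycleForm y + 2 * (k * k)
cycleForm-≥-rotated-chord         zero    y y≤k k≤chord = cycleForm-≥-chord y y≤k k≤chord
cycleForm-≥-rotated-chord {k = k} (suc r) y y≤k k≤chord =
  subst₂ (λ s p → k * s ≤ p + 2 * (k * k)) (sumFin-rotate y) (cycleForm-rotate y)
    (cycleForm-≥-rotated-chord r (rotate y) (y≤k ∘ next) k≤chord)

chordWeights : (Fin 5 → ℕ) → Fin 5 → ℕ
chordWeights y i = y i + y (next (next (next i)))

sumFin-chordWeights : ∀ y → sumFin 5 (chordWeights y) ≡ 2 * sumFin 5 y
sumFin-chordWeights y = double (y (# 0)) (y (# 1)) (y (# 2)) (y (# 3)) (y (# 4))
  where
  double : ∀ a b c d e →
    a + d + (b + e + (c + a + (d + b + (e + c + 0)))) ≡ 2 * (a + (b + (c + (d + (e + 0)))))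
  double = solve-∀

-- In each case chordWeights y r is definitionally rotateBy r y (# 0) + rotateBy r y (# 3).
cycleForm-≥-chords : ∀ {k} y → (∀ j → y j ≤ k) → 5 * k ≤ 2 * sumFin 5 y →
  k * sumFin 5 y ≤ cycleForm y + 2 * (k * k)
cycleForm-≥-chords {k} y y≤k 5k≤2Y
  with pigeonhole 4 (chordWeights y) (subst (5 * k ≤_) (sym (sumFin-chordWeights y)) 5k≤2Y)
... | zero                         , k≤chord = cycleForm-≥-rotated-chord 0 y y≤k k≤chord
... | suc zero                     , k≤chord = cycleForm-≥-rotated-chord 1 y y≤k k≤chord
... | suc (suc zero)               , k≤chord = cycleForm-≥-rotated-chord 2 y y≤k k≤chord
... | suc (suc (suc zero))         , k≤chord = cycleForm-≥-rotated-chord 3 y y≤k k≤chord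
... | suc (suc (suc (suc zero)))   , k≤chord = cycleForm-≥-rotated-chord 4 y y≤k k≤chord

37k²≤4[XY+P]-if-3k≤X : ∀ {k X Y P} → 3 * k ≤ X → X + Y ≡ 6 * k → 5 * k ≤ 2 * Y →
  k * Y ≤ P + 2 * (k * k) → 37 * (k * k) ≤ 4 * (X * Y + P)
37k²≤4[XY+P]-if-3k≤X {k} {X} {Y} {P} 3k≤X X+Y≡6k 5k≤2Y kY≤P+2k² =
  +-cancelʳ-≤ (8 * (k * k)) _ _ (begin
    37 * (k * k) + 8 * (k * k)          ≡⟨ e₁ k ⟩
    5 * k * (9 * k)                     ≤⟨ c*d≤a*b 5k≤2Y 5k≤2[X+k] 2Y+2[X+k]≡5k+9k ⟩
    2 * Y * (2 * (X + k))               ≡⟨ e₂ X Y k ⟩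
    4 * (X * Y) + 4 * (k * Y)           ≤⟨ +-monoʳ-≤ (4 * (X * Y)) (*-monoʳ-≤ 4 kY≤P+2k²) ⟩
    4 * (X * Y) + 4 * (P + 2 * (k * k)) ≡⟨ e₃ X Y P k ⟩
    4 * (X * Y + P) + 8 * (k * k)       ∎)
  where
  open ≤-Reasoning
  e₁ : ∀ k → 37 * (k * k) + 8 * (k * k) ≡ 5 * k * (9 * k)
  e₁ = solve-∀
  e₂ : ∀ X Y k → 2 * Y * (2 * (X + k)) ≡ 4 * (X * Y) + 4 * (k * Y)
  e₂ = solve-∀
  e₃ : ∀ X Y P k → 4 * (X * Y) + 4 * (P + 2 * (k * k)) ≡ 4 * (X * Y + P) + 8 * (k * k)
  e₃ = solve-∀
  5k≤2[X+k] : 5 * k ≤ 2 * (X + k)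
  5k≤2[X+k] = begin
    5 * k             ≤⟨ m≤m+n (5 * k) (3 * k) ⟩
    5 * k + 3 * k     ≡⟨ arith k ⟩
    2 * (3 * k + k)   ≤⟨ *-monoʳ-≤ 2 (+-monoˡ-≤ k 3k≤X) ⟩
    2 * (X + k)       ∎
    where
    arith : ∀ k → 5 * k + 3 * k ≡ 2 * (3 * k + k)
    arith = solve-∀
  2Y+2[X+k]≡5k+9k : 2 * Y + 2 * (X + k) ≡ 5 * k + 9 * k
  2Y+2[X+k]≡5k+9k = begin-equality
    2 * Y + 2 * (X + k)  ≡⟨ arith X Y k ⟩
    2 * (X + Y) + 2 * k  ≡⟨ cong (λ s → 2 * s + 2 * k) X+Y≡6k ⟩
    2 * (6 * k) + 2 * k  ≡⟨ arith′ k ⟩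
    5 * k + 9 * k        ∎
    where
    arith : ∀ X Y k → 2 * Y + 2 * (X + k) ≡ 2 * (X + Y) + 2 * k
    arith = solve-∀
    arith′ : ∀ k → 2 * (6 * k) + 2 * k ≡ 5 * k + 9 * k
    arith′ = solve-∀

37k²≤4[XY+P]-if-3k≤Y : ∀ {k X Y P} → 3 * k ≤ Y → Y ≤ 5 * k → X + Y ≡ 6 * k →
  2 * (k * Y) ≤ P + 5 * (k * k) → 37 * (k * k) ≤ 4 * (X * Y + P)
37k²≤4[XY+P]-if-3k≤Y {k} {X} {Y} {P} 3k≤Y Y≤5k X+Y≡6k 2kY≤P+5k² =
  ≤-trans (*-monoˡ-≤ (k * k) (m≤m+n 37 3)) (+-cancelʳ-≤ (20 * (k * k)) _ _ (begin
    40 * (k * k) + 20 * (k * k)          ≡⟨ e₁ k ⟩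
    4 * (3 * k * (5 * k))                ≤⟨ *-monoʳ-≤ 4 (c*d≤a*b 3k≤Y 3k≤X+2k Y+[X+2k]≡3k+5k) ⟩
    4 * (Y * (X + 2 * k))                ≡⟨ e₂ X Y k ⟩
    4 * (X * Y) + 4 * (2 * (k * Y))      ≤⟨ +-monoʳ-≤ (4 * (X * Y)) (*-monoʳ-≤ 4 2kY≤P+5k²) ⟩
    4 * (X * Y) + 4 * (P + 5 * (k * k))  ≡⟨ e₃ X Y P k ⟩
    4 * (X * Y + P) + 20 * (k * k)       ∎))
  where
  open ≤-Reasoning
  e₁ : ∀ k → 40 * (k * k) + 20 * (k * k) ≡ 4 * (3 * k * (5 * k))
  e₁ = solve-∀
  e₂ : ∀ X Y k → 4 * (Y * (X + 2 * k)) ≡ 4 * (X * Y) + 4 * (2 * (k * Y))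
  e₂ = solve-∀
  e₃ : ∀ X Y P k → 4 * (X * Y) + 4 * (P + 5 * (k * k)) ≡ 4 * (X * Y + P) + 20 * (k * k)
  e₃ = solve-∀
  e₄ : ∀ X Y k → Y + (X + 2 * k) ≡ X + Y + 2 * k
  e₄ = solve-∀
  Y+[X+2k]≡3k+5k : Y + (X + 2 * k) ≡ 3 * k + 5 * k
  Y+[X+2k]≡3k+5k = trans (e₄ X Y k) (trans (cong (_+ 2 * k) X+Y≡6k) (arith k))
    where
    arith : ∀ k → 6 * k + 2 * k ≡ 3 * k + 5 * k
    arith = solve-∀
  3k≤X+2k : 3 * k ≤ X + 2 * k
  3k≤X+2k = +-cancelʳ-≤ (5 * k) _ _ (begin
    3 * k + 5 * k     ≡⟨ Y+[X+2k]≡3k+5k ⟨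
    Y + (X + 2 * k)   ≡⟨ +-comm Y _ ⟩
    X + 2 * k + Y     ≤⟨ +-monoʳ-≤ (X + 2 * k) Y≤5k ⟩
    X + 2 * k + 5 * k ∎)

37k²≤4[XY+P] : ∀ {k} X y → (∀ j → y j ≤ k) → X + sumFin 5 y ≡ 6 * k → 5 * k ≤ 2 * sumFin 5 y →
  37 * (k * k) ≤ 4 * (X * sumFin 5 y + cycleForm y)
37k²≤4[XY+P] {k} X y y≤k X+Y≡6k 5k≤2Y with ≤-total (3 * k) X
... | inj₁ 3k≤X = 37k²≤4[XY+P]-if-3k≤X {k} {X} 3k≤X X+Y≡6k 5k≤2Y (cycleForm-≥-chords y y≤k 5k≤2Y)
... | inj₂ X≤3k = 37k²≤4[XY+P]-if-3k≤Y {k} {X} {P = cycleForm y}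
                   3k≤Y (sumFin-≤ 5 y y≤k) X+Y≡6k (cycleForm-≥-edges y y≤k)
  where
  open ≤-Reasoning
  3k≤Y : 3 * k ≤ sumFin 5 y
  3k≤Y = +-cancelˡ-≤ (3 * k) _ _ (begin
    3 * k + 3 * k      ≡⟨ arith k ⟩
    6 * k              ≡⟨ X+Y≡6k ⟨
    X + sumFin 5 y     ≤⟨ +-monoˡ-≤ (sumFin 5 y) X≤3k ⟩
    3 * k + sumFin 5 y ∎)
    where
    arith : ∀ k → 3 * k + 3 * k ≡ 6 * k
    arith = solve-∀

37k²≤4e-if-cycle-heavy : ∀ k (A : VSet (blowup H k)) → card (blowup H k) A ≡ 6 * k →
  5 * k ≤ 2 * sumFin 5 (cycleCounts (copies k (bool→ℕ ∘ A))) → 37 * (k * k) ≤ 4 * e (blowup H k) A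
37k²≤4e-if-cycle-heavy k A |A|≡6k 5k≤2Y =
  subst (λ x → 37 * (k * k) ≤ 4 * x) (sym (e-blowup-H k A c (λ _ → refl)))
    (37k²≤4[XY+P] (independentCount c) (cycleCounts c) (copies-≤ k A ∘ (7 ↑ʳ_))
      (trans (sym (trans (card-blowup H k A) (sumFin-↑ 7 5 c))) |A|≡6k) 5k≤2Y)
  where
  c = copies k (bool→ℕ ∘ A)

lower-bound : ∀ k (A : VSet (blowup H k)) → Balanced (blowup H k) A → 37 * (k * k) ≤ 4 * maxE (blowup H k) A
lower-bound k A bal = Sum.[_,_]′
    (λ Yᶜ≤Y → ≤-trans (37k²≤4e-if-cycle-heavy k A |A|≡6k (larger-half Y+Yᶜ≡5k Yᶜ≤Y))
                      (*-monoʳ-≤ 4 (m≤m⊔n (e G A) (e G Aᶜ))))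
    (λ Y≤Yᶜ → ≤-trans (37k²≤4e-if-cycle-heavy k Aᶜ (trans (sym bal) |A|≡6k)
                        (larger-half (trans (+-comm Yᶜ Y) Y+Yᶜ≡5k) Y≤Yᶜ))
                      (*-monoʳ-≤ 4 (m≤n⊔m (e G A) (e G Aᶜ))))
  (≤-total Yᶜ Y)
  where
  G = blowup H k
  Aᶜ = compl G A
  c : Fin 12 → ℕ
  c = copies k (bool→ℕ ∘ A)
  cᶜ : Fin 12 → ℕ
  cᶜ = copies k (bool→ℕ ∘ not ∘ A)
  Y = sumFin 5 (cycleCounts c)
  Yᶜ = sumFin 5 (cycleCounts cᶜ)
  |A|≡6k : card (blowup H k) A ≡ 6 * k
  |A|≡6k = *-cancelˡ-≡ _ _ 2 (trans (balanced⇒2*card≡size G A bal) (*-assoc 2 6 k))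
  Y+Yᶜ≡5k : Y + Yᶜ ≡ 5 * k
  Y+Yᶜ≡5k = trans (sym (sumFin-+ 5 (cycleCounts c) (cycleCounts cᶜ)))
    (trans (sumFin-cong 5 (copies-compl k A ∘ (7 ↑ʳ_))) (sumFin-const 5 k))
  larger-half : ∀ {a b s} → a + b ≡ s → b ≤ a → s ≤ 2 * a
  larger-half {a} a+b≡s b≤a = subst₂ _≤_ a+b≡s (cong (a +_) (sym (+-identityʳ a))) (+-monoʳ-≤ a b≤a)

lower-bound-2n : ∀ n A → Balanced (blowup H (2 * n)) A → 37 * (n * n) ≤ maxE (blowup H (2 * n)) A
lower-bound-2n n A bal =
  *-cancelˡ-≤ 4 (subst (_≤ 4 * maxE (blowup H (2 * n)) A) (scale n) (lower-bound (2 * n) A bal))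
  where
  scale : ∀ n → 37 * (2 * n * (2 * n)) ≡ 4 * (37 * (n * n))
  scale = solve-∀

data Fill : Set where
  full empty half : Fill

fillCount : ℕ → Fill → ℕ
fillCount n full  = 2 * n
fillCount n empty = 0
fillCount n half  = n

opposite : Fill → Fill
opposite full  = empty
opposite empty = full
opposite half  = half

fillCount-opposite : ∀ n f → fillCount n f + fillCount n (opposite f) ≡ 2 * n
fillCount-opposite n full  = +-identityʳ (2 * n)
fillCount-opposite n empty = refl
fillCount-opposite n half  = cong (n +_) (sym (+-identityʳ n))

extremalFill : Fin 12 → Fill
extremalFill = lookup (full ∷ full ∷ full ∷ half ∷ empty ∷ empty ∷ empty
                    ∷ full ∷ empty ∷ full ∷ empty ∷ half ∷ [])

extremalSet : ∀ n → VSet (blowup H (2 * n))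
extremalSet n = realise (2 * n) (fillCount n ∘ extremalFill)

copies-extremalSet : ∀ n u → copies (2 * n) (bool→ℕ ∘ extremalSet n) u ≡ fillCount n (extremalFill u)
copies-extremalSet n = copies-realise (2 * n) (fillCount n ∘ extremalFill)
  (λ u → subst (fillCount n (extremalFill u) ≤_) (fillCount-opposite n (extremalFill u)) (m≤m+n _ _))

copies-extremalSetᶜ : ∀ n u →
  copies (2 * n) (bool→ℕ ∘ not ∘ extremalSet n) u ≡ fillCount n (opposite (extremalFill u))
copies-extremalSetᶜ n u = +-cancelˡ-≡ (fillCount n (extremalFill u)) _ _ (begin
  fillCount n (extremalFill u) + copies (2 * n) (bool→ℕ ∘ not ∘ extremalSet n) u
    ≡⟨ cong (_+ copies (2 * n) (bool→ℕ ∘ not ∘ extremalSet n) u) (copies-extremalSet n u) ⟨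
  copies (2 * n) (bool→ℕ ∘ extremalSet n) u + copies (2 * n) (bool→ℕ ∘ not ∘ extremalSet n) u
    ≡⟨ copies-compl (2 * n) (extremalSet n) u ⟩
  2 * n
    ≡⟨ fillCount-opposite n (extremalFill u) ⟨
  fillCount n (extremalFill u) + fillCount n (opposite (extremalFill u)) ∎)
  where open ≡-Reasoning

-- The left-hand sides of the evaluate lemmas are the sums over the explicit count vectors, unfolded.
HForm-extremal : ∀ n → HForm (fillCount n ∘ extremalFill) ≡ 37 * (n * n)
HForm-extremal n = evaluate n
  where
  evaluate : ∀ n →
    (2 * n + (2 * n + (2 * n + (n + (0 + (0 + (0 + 0))))))) * (2 * n + (0 + (2 * n + (0 + (n + 0)))))
      + (2 * n * 0 + 0 * (2 * n) + 2 * n * 0 + 0 * n + n * (2 * n))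
      ≡ 37 * (n * n)
  evaluate = solve-∀

HForm-extremalᶜ : ∀ n → HForm (fillCount n ∘ opposite ∘ extremalFill) ≡ 37 * (n * n)
HForm-extremalᶜ n = evaluate n
  where
  evaluate : ∀ n →
    (0 + (0 + (0 + (n + (2 * n + (2 * n + (2 * n + 0))))))) * (0 + (2 * n + (0 + (2 * n + (n + 0)))))
      + (0 * (2 * n) + 2 * n * 0 + 0 * (2 * n) + 2 * n * n + n * 0)
      ≡ 37 * (n * n)
  evaluate = solve-∀

extremalSet-balanced : ∀ n → Balanced (blowup H (2 * n)) (extremalSet n)
extremalSet-balanced n = begin
  card G A                                                  ≡⟨ card-blowup H (2 * n) A ⟩
  sumFin 12 (copies (2 * n) (bool→ℕ ∘ A))                   ≡⟨ sumFin-cong 12 (copies-extremalSet n) ⟩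
  sumFin 12 (fillCount n ∘ extremalFill)                    ≡⟨ evaluate n ⟩
  sumFin 12 (fillCount n ∘ opposite ∘ extremalFill)         ≡⟨ sumFin-cong 12 (copies-extremalSetᶜ n) ⟨
  sumFin 12 (copies (2 * n) (bool→ℕ ∘ not ∘ A))             ≡⟨ card-blowup H (2 * n) (compl G A) ⟨
  card G (compl G A)                                        ∎
  where
  open ≡-Reasoning
  G = blowup H (2 * n)
  A = extremalSet n
  evaluate : ∀ n →
    2 * n + (2 * n + (2 * n + (n + (0 + (0 + (0 + (2 * n + (0 + (2 * n + (0 + (n + 0)))))))))))
      ≡ 0 + (0 + (0 + (n + (2 * n + (2 * n + (2 * n + (0 + (2 * n + (0 + (2 * n + (n + 0)))))))))))
  evaluate = solve-∀

maxE-extremalSet : ∀ n → maxE (blowup H (2 * n)) (extremalSet n) ≡ 37 * (n * n)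
maxE-extremalSet n = trans
  (cong₂ _⊔_ (trans (e-blowup-H (2 * n) A _ (copies-extremalSet n)) (HForm-extremal n))
             (trans (e-blowup-H (2 * n) (compl G A) _ (copies-extremalSetᶜ n)) (HForm-extremalᶜ n)))
  (⊔-idem (37 * (n * n)))
  where
  G = blowup H (2 * n)
  A = extremalSet n

size-identity : ∀ n → 24 ^ 2 * (37 * (n * n)) ≡ 37 * ((12 * (2 * n)) ^ 2)
size-identity n = arith n
  where
  arith : ∀ n → 576 * (37 * (n * n)) ≡ 37 * (12 * (2 * n) * (12 * (2 * n) * 1))
  arith = solve-∀

size-inequality : ∀ n → 1 ≤ n → (12 * (2 * n)) ^ 2 < 16 * (37 * (n * n))
size-inequality n 1≤n =
  subst₂ _<_ (sym (e₁ n)) (sym (e₂ n)) (*-monoˡ-< (n * n) {{m*n≢0 n n}} (m<m+n 576 {16} z<s))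
  where
  instance
    n≢0 : NonZero n
    n≢0 = >-nonZero 1≤n
  e₁ : ∀ n → 12 * (2 * n) * (12 * (2 * n) * 1) ≡ 576 * (n * n)
  e₁ = solve-∀
  e₂ : ∀ n → 16 * (37 * (n * n)) ≡ 592 * (n * n)
  e₂ = solve-∀

theorem1p6 : ∀ (n : ℕ) → 1 ≤ n →
    Σ ℕ λ d →
      IsD2∞b (blowup H (2 * n)) d
      × (24 ^ 2) * d ≡ 37 * (∣ blowup H (2 * n) ∣ᵥ ^ 2)
      × (∣ blowup H (2 * n) ∣ᵥ ^ 2) < 16 * d
theorem1p6 n 1≤n =
  37 * (n * n) ,
  ((extremalSet n , extremalSet-balanced n , maxE-extremalSet n) , lower-bound-2n n) ,
  size-identity n ,
  size-inequality n 1≤n
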